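{- Let $n\ge k\ge 3$ and let $U_1$ be the graph consisting of a triangle $v_1v_2v_3$ together with $k-3$ pendant vertices each adjacent only to $v_1$ (so $U_1$ has $k$ vertices and $k$ edges). Let $\Gamma=(K_n,U_1^-)$. Then, with $u=n-k$, $$\varphi(\Gamma,\lambda)=(\lambda+1)^{n-5}(\lambda-1)\Big(\lambda^4+(6-n)\lambda^3+(16-5n)\lambda^2+(4k-11n+4ku+18)\lambda+28k-31n+12ku+7\Big).$$
   Context: For a subgraph $H$ of $K_n$, $(K_n,H^-)$ denotes $K_n$ with the edges of $H$ negative and all other edges positive; its adjacency matrix has entries $-1$ on edges of $H$, $+1$ on other pairs of distinct vertices, and $0$ on the diagonal. $\varphi(\Gamma,\lambda)=\det(\lambda I-A(\Gamma))$. -}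

module Defs where

open import Data.Nat as ℕ using (ℕ; zero; suc; _<ᵇ_; _≡ᵇ_)
open import Data.Integer using (ℤ; +_; -_; _+_; _-_; _*_; _^_)
open import Data.Fin using (Fin; zero; suc; toℕ; punchIn; _≟_)
open import Data.Bool using (Bool; true; false; if_then_else_; _∧_; _∨_)
open import Relation.Nullary.Decidable using (⌊_⌋)

sumFin : ∀ n → (Fin n → ℤ) → ℤ
sumFin zero    f = + 0
sumFin (suc n) f = f zero + sumFin n (λ i → f (suc i))

det : ∀ n → (Fin n → Fin n → ℤ) → ℤ
det zero    M = + 1
det (suc n) M =
  sumFin (suc n) (λ j →
    ((- (+ 1)) ^ toℕ j) * M zero j * det n (λ r c → M (suc r) (punchIn j c)))

δ : ∀ {n} → Fin n → Fin n → ℤ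
δ i j = if ⌊ i ≟ j ⌋ then + 1 else + 0

charPoly : ∀ n → (Fin n → Fin n → ℤ) → ℤ → ℤ
charPoly n A x = det n (λ i j → x * δ i j - A i j)

-- Adjacency matrix of (K_n, H^-), H given by its (symmetric) edge relation:
-- 0 on the diagonal, -1 on edges of H, +1 on other pairs of distinct vertices.
signedKnAdj : ∀ n → (Fin n → Fin n → Bool) → Fin n → Fin n → ℤ
signedKnAdj n H i j =
  if ⌊ i ≟ j ⌋ then + 0 else (if H i j then - (+ 1) else + 1)

-- The graph U₁ inside K_n (vertex labels 0,1,2 = v₁,v₂,v₃ forming a triangle,
-- vertices 3,…,k-1 pendant vertices adjacent only to v₁ = 0;
-- vertices k,…,n-1 are not in U₁).
-- {i,j} (i ≠ j) is an edge iff both are < k and either both are < 3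
-- (triangle edge) or one of them is 0 (pendant edge).
U₁ : ∀ {n} → ℕ → Fin n → Fin n → Bool
U₁ k i j =
  (toℕ i <ᵇ k) ∧ (toℕ j <ᵇ k) ∧
  (((toℕ i <ᵇ 3) ∧ (toℕ j <ᵇ 3)) ∨ (toℕ i ≡ᵇ 0) ∨ (toℕ j ≡ᵇ 0))

-- In λI − A two twin vertices u, v (same type: same signs towards every other
-- vertex) give rows and columns that agree outside their 2 × 2 block. Subtracting row v
-- from row u and expanding along the result gives
--   φ(Γ) = y (2 φ(Γ − v) − y φ(Γ − u − v)),   y = λ + A_uv.
-- The pendant vertices of U₁ and the vertices outside U₁ are two such twin classes, both
-- with y = λ + 1. Solving the recurrence in the number p of pendants and in the number u
-- of outside vertices expresses φ through the four cases p, u ≤ 1, which are expanded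
-- directly (3 × 3 up to 5 × 5); the factorisation is then a polynomial identity in λ, p, u.

module Submission where

open import Defs
open import Data.Bool using (Bool; true; false; if_then_else_)
open import Data.Fin using (Fin; zero; suc; toℕ; punchIn; inject₁; _≟_)
open import Data.Fin.Induction using (<-weakInduction)
open import Data.Fin.Properties using (suc-injective; punchInᵢ≢i; punchIn-injective; toℕ-inject₁)
open import Data.Integer using (ℤ; +_; -_; _+_; _-_; _*_; _^_)
open import Data.Integer.Properties
  using ( +-commutativeSemigroup; +-identityˡ; +-identityʳ; *-identityˡ; *-identityʳ; *-zeroʳ
        ; *-assoc; *-distribˡ-+; neg-involutive; ^-distribˡ-+-* )
open import Algebra.Properties.CommutativeSemigroup +-commutativeSemigroup using (interchange)
open import Data.Integer.Solver using (module +-*-Solver)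
open import Data.Integer.Tactic.RingSolver using (solve-∀)
open import Data.Nat using (ℕ; zero; suc; _≤_; _∸_; _<ᵇ_)
import Data.Nat as ℕ
import Data.Nat.Properties as ℕₚ
open import Data.Product using (_×_; _,_; proj₁)
import Data.Vec as Vec
open import Data.Vec.Functional using (updateAt; _∷_)
open import Data.Vec.Functional.Properties using (updateAt-updates; updateAt-minimal)
open import Function using (_∘_; const; case_of_)
open import Relation.Binary.PropositionalEquality
open import Relation.Nullary using (yes; no; contradiction)
open import Relation.Nullary.Decidable using (⌊_⌋)

open +-*-Solver using (Polynomial; con; var; ⟦_⟧; _:+_; _:*_; _:-_; _:^_; _:=_; solve)
open ≡-Reasoning

private variable
  n : ℕ

sumFin-cong : ∀ n {f g : Fin n → ℤ} → f ≗ g → sumFin n f ≡ sumFin n g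
sumFin-cong zero    f≗g = refl
sumFin-cong (suc n) f≗g = cong₂ _+_ (f≗g zero) (sumFin-cong n (f≗g ∘ suc))

sumFin-+ : ∀ n (f g : Fin n → ℤ) → sumFin n (λ i → f i + g i) ≡ sumFin n f + sumFin n g
sumFin-+ zero    f g = refl
sumFin-+ (suc n) f g = begin
  f zero + g zero + sumFin n (λ i → f (suc i) + g (suc i))
    ≡⟨ cong (_+_ (f zero + g zero)) (sumFin-+ n (f ∘ suc) (g ∘ suc)) ⟩
  f zero + g zero + (sumFin n (f ∘ suc) + sumFin n (g ∘ suc))
    ≡⟨ interchange (f zero) (g zero) _ _ ⟩
  sumFin (suc n) f + sumFin (suc n) g ∎

sumFin-*ˡ : ∀ n a (f : Fin n → ℤ) → sumFin n (λ i → a * f i) ≡ a * sumFin n f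
sumFin-*ˡ zero    a f = sym (*-zeroʳ a)
sumFin-*ˡ (suc n) a f = begin
  a * f zero + sumFin n (λ i → a * f (suc i)) ≡⟨ cong (_+_ (a * f zero)) (sumFin-*ˡ n a (f ∘ suc)) ⟩
  a * f zero + a * sumFin n (f ∘ suc)         ≡⟨ *-distribˡ-+ a (f zero) _ ⟨
  a * sumFin (suc n) f                         ∎

sumFin-linear : ∀ n a b (f g : Fin n → ℤ) →
  sumFin n (λ i → a * f i + b * g i) ≡ a * sumFin n f + b * sumFin n g
sumFin-linear n a b f g =
  trans (sumFin-+ n _ _) (cong₂ _+_ (sumFin-*ˡ n a f) (sumFin-*ˡ n b g))

sumFin-zero : ∀ n (f : Fin n → ℤ) → (∀ i → f i ≡ + 0) → sumFin n f ≡ + 0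
sumFin-zero zero    f f≡0 = refl
sumFin-zero (suc n) f f≡0 = cong₂ _+_ (f≡0 zero) (sumFin-zero n (f ∘ suc) (f≡0 ∘ suc))

sumFin-single : ∀ n (f : Fin n → ℤ) j → (∀ i → i ≢ j → f i ≡ + 0) → sumFin n f ≡ f j
sumFin-single (suc n) f zero    f≡0 = begin
  f zero + sumFin n (f ∘ suc) ≡⟨ cong (_+_ (f zero)) (sumFin-zero n _ (λ i → f≡0 (suc i) λ ())) ⟩
  f zero + + 0                ≡⟨ +-identityʳ (f zero) ⟩
  f zero                      ∎
sumFin-single (suc n) f (suc j) f≡0 = begin
  f zero + sumFin n (f ∘ suc) ≡⟨ cong₂ _+_ (f≡0 zero λ ()) (sumFin-single n (f ∘ suc) j
                                   (λ i i≢j → f≡0 (suc i) (i≢j ∘ suc-injective))) ⟩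
  + 0 + f (suc j)             ≡⟨ +-identityˡ (f (suc j)) ⟩
  f (suc j)                   ∎

-- Determinants

Matrix : ℕ → Set
Matrix n = Fin n → Fin n → ℤ

sgn : ℕ → ℤ
sgn k = (- (+ 1)) ^ k

minor : Fin (suc n) → Fin (suc n) → Matrix (suc n) → Matrix n
minor p q M a b = M (punchIn p a) (punchIn q b)

det-cong : ∀ n {M N : Matrix n} → (∀ i j → M i j ≡ N i j) → det n M ≡ det n N
det-cong zero    M≐N = refl
det-cong (suc n) M≐N = sumFin-cong (suc n) λ j →
  cong₂ (λ e d → sgn (toℕ j) * e * d) (M≐N zero j) (det-cong n λ a c → M≐N (suc a) (punchIn j c))

infixl 5 _[_]≔_
_[_]≔_ : Matrix n → Fin n → (Fin n → ℤ) → Matrix n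
M [ r ]≔ v = updateAt M r (const v)

[]≔-updates : ∀ (M : Matrix n) r v j → (M [ r ]≔ v) r j ≡ v j
[]≔-updates M r v j = cong (λ row → row j) (updateAt-updates r M)

[]≔-minimal : ∀ (M : Matrix n) r v {i} → i ≢ r → ∀ j → (M [ r ]≔ v) i j ≡ M i j
[]≔-minimal M r v {i} i≢r j = cong (λ row → row j) (updateAt-minimal i r M i≢r)

minor-[]≔ : ∀ (M : Matrix (suc n)) j r v a c →
  minor zero j (M [ suc r ]≔ v) a c ≡ (minor zero j M [ r ]≔ (v ∘ punchIn j)) a c
minor-[]≔ M j r v a c with a ≟ r
... | yes refl = trans ([]≔-updates M (suc r) v _) (sym ([]≔-updates _ r _ c))
... | no a≢r   =
  trans ([]≔-minimal M (suc r) v (a≢r ∘ suc-injective) _) (sym ([]≔-minimal _ r _ a≢r c))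

det-[suc]≔ : ∀ n (M : Matrix (suc n)) r v → det (suc n) (M [ suc r ]≔ v)
  ≡ sumFin (suc n) (λ j → sgn (toℕ j) * M zero j * det n (minor zero j M [ r ]≔ (v ∘ punchIn j)))
det-[suc]≔ n M r v = sumFin-cong (suc n) λ j →
  cong (sgn (toℕ j) * M zero j *_) (det-cong n (minor-[]≔ M j r v))

det-row-linear : ∀ n (M : Matrix n) r a b (v u₁ u₂ : Fin n → ℤ) →
  (∀ j → v j ≡ a * u₁ j + b * u₂ j) →
  det n (M [ r ]≔ v) ≡ a * det n (M [ r ]≔ u₁) + b * det n (M [ r ]≔ u₂)
det-row-linear (suc n) M zero a b v u₁ u₂ v≡ = begin
  sumFin (suc n) (term v)
    ≡⟨ sumFin-cong (suc n) (λ j → trans (cong (λ e → sgn (toℕ j) * e * d j) (v≡ j))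
                                         (distrib (sgn (toℕ j)) a b (u₁ j) (u₂ j) (d j))) ⟩
  sumFin (suc n) (λ j → a * term u₁ j + b * term u₂ j)
    ≡⟨ sumFin-linear (suc n) a b (term u₁) (term u₂) ⟩
  a * sumFin (suc n) (term u₁) + b * sumFin (suc n) (term u₂) ∎
  where
  d : Fin (suc n) → ℤ
  d j = det n (minor zero j M)
  term : (Fin (suc n) → ℤ) → Fin (suc n) → ℤ
  term u j = sgn (toℕ j) * u j * d j
  distrib : ∀ s a b u₁ u₂ d → s * (a * u₁ + b * u₂) * d ≡ a * (s * u₁ * d) + b * (s * u₂ * d)
  distrib = solve-∀
det-row-linear (suc n) M (suc r) a b v u₁ u₂ v≡ = begin
  det (suc n) (M [ suc r ]≔ v)
    ≡⟨ det-[suc]≔ n M r v ⟩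
  sumFin (suc n) (term v)
    ≡⟨ sumFin-cong (suc n) (λ j → trans
         (cong (sgn (toℕ j) * M zero j *_)
               (det-row-linear n (minor zero j M) r a b _ _ _ (v≡ ∘ punchIn j)))
         (distrib (sgn (toℕ j) * M zero j) a b _ _)) ⟩
  sumFin (suc n) (λ j → a * term u₁ j + b * term u₂ j)
    ≡⟨ sumFin-linear (suc n) a b (term u₁) (term u₂) ⟩
  a * sumFin (suc n) (term u₁) + b * sumFin (suc n) (term u₂)
    ≡⟨ cong₂ (λ e f → a * e + b * f) (det-[suc]≔ n M r u₁) (det-[suc]≔ n M r u₂) ⟨
  a * det (suc n) (M [ suc r ]≔ u₁) + b * det (suc n) (M [ suc r ]≔ u₂) ∎
  where
  term : (Fin (suc n) → ℤ) → Fin (suc n) → ℤ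
  term u j = sgn (toℕ j) * M zero j * det n (minor zero j M [ r ]≔ (u ∘ punchIn j))
  distrib : ∀ s a b e f → s * (a * e + b * f) ≡ a * (s * e) + b * (s * f)
  distrib = solve-∀

doubleLaplace : ∀ m → (Fin (suc (suc m)) → ℤ) → ((Fin m → Fin (suc (suc m))) → ℤ) → ℤ
doubleLaplace m w D = sumFin (suc (suc m)) λ j → sgn (toℕ j) * w j *
  sumFin (suc m) λ c → sgn (toℕ c) * w (punchIn j c) * D (punchIn j ∘ punchIn c)

-- The terms that use column 0 in one of the two expanded rows cancel in pairs.
doubleLaplace-cancel : ∀ m w D → doubleLaplace m w D
  ≡ sumFin (suc m) λ j → sgn (toℕ (suc j)) * w (suc j) *
      sumFin m λ c → sgn (toℕ (suc c)) * w (suc (punchIn j c)) * D (punchIn (suc j) ∘ punchIn (suc c))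
doubleLaplace-cancel m w D = begin
  + 1 * w zero * sumFin (suc m) P
    + sumFin (suc m) (λ j → sgn (toℕ (suc j)) * w (suc j) * (+ 1 * w zero * E j + R j))
    ≡⟨ cong (_+_ (+ 1 * w zero * sumFin (suc m) P)) (begin
         sumFin (suc m) (λ j → sgn (toℕ (suc j)) * w (suc j) * (+ 1 * w zero * E j + R j))
           ≡⟨ sumFin-cong (suc m) (λ j → split (sgn (toℕ j)) (w (suc j)) (w zero) (E j) (R j)) ⟩
         sumFin (suc m) (λ j → - w zero * P j + Y j)
           ≡⟨ sumFin-+ (suc m) (λ j → - w zero * P j) Y ⟩
         sumFin (suc m) (λ j → - w zero * P j) + sumFin (suc m) Y
           ≡⟨ cong (_+ sumFin (suc m) Y) (sumFin-*ˡ (suc m) (- w zero) P) ⟩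
         - w zero * sumFin (suc m) P + sumFin (suc m) Y ∎) ⟩
  + 1 * w zero * sumFin (suc m) P + (- w zero * sumFin (suc m) P + sumFin (suc m) Y)
    ≡⟨ cancel (w zero) (sumFin (suc m) P) (sumFin (suc m) Y) ⟩
  sumFin (suc m) Y ∎
  where
  E : Fin (suc m) → ℤ
  E j = D (suc ∘ punchIn j)
  P : Fin (suc m) → ℤ
  P j = sgn (toℕ j) * w (suc j) * E j
  R : Fin (suc m) → ℤ
  R j = sumFin m λ c → sgn (toℕ (suc c)) * w (suc (punchIn j c)) * D (punchIn (suc j) ∘ punchIn (suc c))
  Y : Fin (suc m) → ℤ
  Y j = sgn (toℕ (suc j)) * w (suc j) * R j
  split : ∀ s w₁ w₀ e r → - (+ 1) * s * w₁ * (+ 1 * w₀ * e + r) ≡ - w₀ * (s * w₁ * e) + - (+ 1) * s * w₁ * r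
  split = solve-∀
  cancel : ∀ w₀ p y → + 1 * w₀ * p + (- w₀ * p + y) ≡ y
  cancel = solve-∀

doubleLaplace-vanishes : ∀ m w (D : (Fin m → Fin (suc (suc m))) → ℤ) →
  (∀ {f g} → f ≗ g → D f ≡ D g) → doubleLaplace m w D ≡ + 0
doubleLaplace-vanishes zero    w D D-ext =
  trans (doubleLaplace-cancel zero w D) (sumFin-zero 1 _ λ j → *-zeroʳ (sgn (toℕ (suc j)) * w (suc j)))
doubleLaplace-vanishes (suc m) w D D-ext = begin
  doubleLaplace (suc m) w D
    ≡⟨ doubleLaplace-cancel (suc m) w D ⟩
  sumFin (suc (suc m)) (λ j → sgn (toℕ (suc j)) * w (suc j) * sumFin (suc m) (term (suc j) ∘ suc))
    ≡⟨ sumFin-cong (suc (suc m)) (λ j → trans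
         (cong (sgn (toℕ (suc j)) * w (suc j) *_)
               (trans (sumFin-cong (suc m) (shift j)) (sumFin-*ˡ (suc m) (- (+ 1)) (term′ j))))
         (signs (sgn (toℕ j)) (w (suc j)) (sumFin (suc m) (term′ j)))) ⟩
  doubleLaplace m (w ∘ suc) D′
    ≡⟨ doubleLaplace-vanishes m (w ∘ suc) D′ D′-ext ⟩
  + 0 ∎
  where
  D′ : (Fin m → Fin (suc (suc m))) → ℤ
  D′ τ = D (zero ∷ suc ∘ τ)
  D′-ext : ∀ {f g} → f ≗ g → D′ f ≡ D′ g
  D′-ext f≗g = D-ext λ { zero → refl ; (suc k) → cong suc (f≗g k) }
  term : Fin (suc (suc (suc m))) → Fin (suc (suc m)) → ℤ
  term j c = sgn (toℕ c) * w (punchIn j c) * D (punchIn j ∘ punchIn c)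
  term′ : Fin (suc (suc m)) → Fin (suc m) → ℤ
  term′ j c = sgn (toℕ c) * w (suc (punchIn j c)) * D′ (punchIn j ∘ punchIn c)
  shift : ∀ j c → term (suc j) (suc c) ≡ - (+ 1) * term′ j c
  shift j c = trans (cong (sgn (toℕ (suc c)) * w (suc (punchIn j c)) *_)
                          (D-ext λ { zero → refl ; (suc k) → refl }))
                    (reassoc (sgn (toℕ c)) _ _)
    where
    reassoc : ∀ s a d → - (+ 1) * s * a * d ≡ - (+ 1) * (s * a * d)
    reassoc = solve-∀
  signs : ∀ s a t → - (+ 1) * s * a * (- (+ 1) * t) ≡ s * a * t
  signs = solve-∀

det-equal-adjacent-rows : ∀ m (M : Matrix (suc (suc m))) r →
  (∀ j → M (inject₁ r) j ≡ M (suc r) j) → det (suc (suc m)) M ≡ + 0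
det-equal-adjacent-rows m M zero rows≡ = begin
  det (suc (suc m)) M
    ≡⟨ sumFin-cong (suc (suc m)) (λ j → cong (sgn (toℕ j) * M zero j *_)
         (sumFin-cong (suc m) λ c → cong (λ e → sgn (toℕ c) * e * D (punchIn j ∘ punchIn c))
                                         (sym (rows≡ (punchIn j c))))) ⟩
  doubleLaplace m (M zero) D
    ≡⟨ doubleLaplace-vanishes m (M zero) D (λ f≗g → det-cong m λ a b → cong (M (suc (suc a))) (f≗g b)) ⟩
  + 0 ∎
  where
  D : (Fin m → Fin (suc (suc m))) → ℤ
  D τ = det m λ a b → M (suc (suc a)) (τ b)
det-equal-adjacent-rows (suc m) M (suc r) rows≡ =
  sumFin-zero (suc (suc (suc m))) _ λ j → trans
    (cong (sgn (toℕ j) * M zero j *_)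
          (det-equal-adjacent-rows m (minor zero j M) r (rows≡ ∘ punchIn j)))
    (*-zeroʳ (sgn (toℕ j) * M zero j))

inject₁≢suc : (r : Fin n) → inject₁ r ≢ suc r
inject₁≢suc (suc r) eq = inject₁≢suc r (suc-injective eq)

punchIn-inject₁-self : (r : Fin (suc n)) → punchIn (inject₁ r) r ≡ suc r
punchIn-inject₁-self zero    = refl
punchIn-inject₁-self {suc n} (suc r) = cong suc (punchIn-inject₁-self r)

punchIn-suc-self : (r : Fin (suc n)) → punchIn (suc r) r ≡ inject₁ r
punchIn-suc-self zero    = refl
punchIn-suc-self {suc n} (suc r) = cong suc (punchIn-suc-self r)

punchIn-inject₁≡punchIn-suc : (r a : Fin (suc n)) → a ≢ r → punchIn (inject₁ r) a ≡ punchIn (suc r) a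
punchIn-inject₁≡punchIn-suc zero    zero    a≢r = contradiction refl a≢r
punchIn-inject₁≡punchIn-suc zero    (suc a) a≢r = refl
punchIn-inject₁≡punchIn-suc {suc n} (suc r) zero    a≢r = refl
punchIn-inject₁≡punchIn-suc {suc n} (suc r) (suc a) a≢r =
  cong suc (punchIn-inject₁≡punchIn-suc r a (a≢r ∘ cong suc))

[]≔-comm : ∀ (M : Matrix n) {i j} → i ≢ j → ∀ u v a b →
  (M [ i ]≔ u [ j ]≔ v) a b ≡ (M [ j ]≔ v [ i ]≔ u) a b
[]≔-comm M {i} {j} i≢j u v a b with a ≟ i | a ≟ j
... | yes refl | _        = trans ([]≔-minimal _ j v i≢j b)
                              (trans ([]≔-updates M i u b) (sym ([]≔-updates _ i u b)))
... | no _     | yes refl = trans ([]≔-updates _ j v b)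
                              (sym (trans ([]≔-minimal _ i u (i≢j ∘ sym) b) ([]≔-updates M j v b)))
... | no a≢i   | no a≢j   = trans ([]≔-minimal _ j v a≢j b)
                              (trans ([]≔-minimal M i u a≢i b)
                                (sym (trans ([]≔-minimal _ i u a≢i b) ([]≔-minimal M j v a≢j b))))

det-row-additive : ∀ n (M : Matrix n) r (u v : Fin n → ℤ) →
  det n (M [ r ]≔ (λ j → u j + v j)) ≡ det n (M [ r ]≔ u) + det n (M [ r ]≔ v)
det-row-additive n M r u v = trans
  (det-row-linear n M r (+ 1) (+ 1) _ u v λ j → sym (cong₂ _+_ (*-identityˡ (u j)) (*-identityˡ (v j))))
  (cong₂ _+_ (*-identityˡ (det n (M [ r ]≔ u))) (*-identityˡ (det n (M [ r ]≔ v))))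

det-swap-adjacent-rows : ∀ m (M : Matrix (suc (suc m))) r →
  det (suc (suc m)) (M [ inject₁ r ]≔ M (suc r) [ suc r ]≔ M (inject₁ r)) ≡ - det (suc (suc m)) M
-- With B f h the matrix whose rows lo and hi are f and h:
-- 0 = det (B (u + v) (u + v)) = det (B u v) + det (B v u).
det-swap-adjacent-rows m M r = begin
  det′ (B v u)                                       ≡⟨ isolate (det′ M) (det′ (B v u)) ⟩
  + 0 + det′ M + (det′ (B v u) + + 0) - det′ M       ≡⟨ cong (_- det′ M) expand-B-s-s ⟩
  + 0 - det′ M                                       ≡⟨ +-identityˡ (- det′ M) ⟩
  - det′ M                                           ∎
  where
  lo hi : Fin (suc (suc m))
  lo = inject₁ r
  hi = suc r
  u v s : Fin (suc (suc m)) → ℤ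
  u = M lo
  v = M hi
  s j = u j + v j
  det′ : Matrix (suc (suc m)) → ℤ
  det′ = det (suc (suc m))
  B : (Fin (suc (suc m)) → ℤ) → (Fin (suc (suc m)) → ℤ) → Matrix (suc (suc m))
  B f h = M [ lo ]≔ f [ hi ]≔ h
  B-equal : ∀ f → det′ (B f f) ≡ + 0
  B-equal f = det-equal-adjacent-rows m (B f f) r λ j →
    trans ([]≔-minimal (M [ lo ]≔ f) hi f (inject₁≢suc r) j)
          (trans ([]≔-updates M lo f j) (sym ([]≔-updates (M [ lo ]≔ f) hi f j)))
  B-additiveˡ : ∀ f g h → det′ (B (λ j → f j + g j) h) ≡ det′ (B f h) + det′ (B g h)
  B-additiveˡ f g h = begin
    det′ (B (λ j → f j + g j) h)                                  ≡⟨ det-cong (suc (suc m)) (comm _) ⟩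
    det′ (M [ hi ]≔ h [ lo ]≔ (λ j → f j + g j))                  ≡⟨ det-row-additive _ (M [ hi ]≔ h) lo f g ⟩
    det′ (M [ hi ]≔ h [ lo ]≔ f) + det′ (M [ hi ]≔ h [ lo ]≔ g)
      ≡⟨ cong₂ _+_ (det-cong (suc (suc m)) (comm f)) (det-cong (suc (suc m)) (comm g)) ⟨
    det′ (B f h) + det′ (B g h)                                   ∎
    where
    comm : ∀ e a b → B e h a b ≡ (M [ hi ]≔ h [ lo ]≔ e) a b
    comm e = []≔-comm M (inject₁≢suc r) e h
  B-u-v : ∀ a b → B u v a b ≡ M a b
  B-u-v a b with a ≟ hi | a ≟ lo
  ... | yes refl | _        = []≔-updates (M [ lo ]≔ u) hi v b
  ... | no a≢hi  | yes refl = trans ([]≔-minimal (M [ lo ]≔ u) hi v a≢hi b) ([]≔-updates M lo u b)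
  ... | no a≢hi  | no a≢lo  = trans ([]≔-minimal (M [ lo ]≔ u) hi v a≢hi b) ([]≔-minimal M lo u a≢lo b)
  expand-B-s-s : + 0 + det′ M + (det′ (B v u) + + 0) ≡ + 0
  expand-B-s-s = begin
    + 0 + det′ M + (det′ (B v u) + + 0)
      ≡⟨ cong₂ _+_ (cong₂ _+_ (B-equal u) (det-cong (suc (suc m)) B-u-v)) (cong (_+_ (det′ (B v u))) (B-equal v)) ⟨
    det′ (B u u) + det′ (B u v) + (det′ (B v u) + det′ (B v v))
      ≡⟨ cong₂ _+_ (det-row-additive _ (M [ lo ]≔ u) hi u v) (det-row-additive _ (M [ lo ]≔ v) hi u v) ⟨
    det′ (B u s) + det′ (B v s)                                   ≡⟨ B-additiveˡ u v s ⟨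
    det′ (B s s)                                                  ≡⟨ B-equal s ⟩
    + 0                                                           ∎
  isolate : ∀ d e → e ≡ + 0 + d + (e + + 0) - d
  isolate = solve-∀

δ-self : (q : Fin n) → δ q q ≡ + 1
δ-self q with q ≟ q
... | yes _   = refl
... | no q≢q = contradiction refl q≢q

δ-other : {q j : Fin n} → q ≢ j → δ q j ≡ + 0
δ-other {q = q} {j} q≢j with q ≟ j
... | yes q≡j = contradiction q≡j q≢j
... | no _    = refl

UnitRowExpansion : ∀ n → Fin (suc n) → Set
UnitRowExpansion n p = ∀ q M → (∀ j → M p j ≡ δ q j) →
  det (suc n) M ≡ sgn (toℕ p ℕ.+ toℕ q) * det n (minor p q M)

unit-row-expansion-first : ∀ n → UnitRowExpansion n zero
unit-row-expansion-first n q M row≡δ = begin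
  det (suc n) M
    ≡⟨ sumFin-single (suc n) _ q (λ j j≢q → trans (cong (λ e → sgn (toℕ j) * e * d j)
                                                 (trans (row≡δ j) (δ-other (j≢q ∘ sym))))
                                           (zero-middle (sgn (toℕ j)) (d j))) ⟩
  sgn (toℕ q) * M zero q * d q  ≡⟨ cong (λ e → sgn (toℕ q) * e * d q) (trans (row≡δ q) (δ-self q)) ⟩
  sgn (toℕ q) * + 1 * d q       ≡⟨ cong (_* d q) (*-identityʳ (sgn (toℕ q))) ⟩
  sgn (toℕ q) * d q             ∎
  where
  d : Fin (suc n) → ℤ
  d j = det n (minor zero j M)
  zero-middle : ∀ s d → s * + 0 * d ≡ + 0
  zero-middle = solve-∀

unit-row-expansion-step : ∀ n (r : Fin n) → UnitRowExpansion n (inject₁ r) → UnitRowExpansion n (suc r)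
-- Swapping rows r and r + 1 moves the unit row up by one.
unit-row-expansion-step (suc m) r IH q M row≡δ = begin
  det′ M                                          ≡⟨ neg-involutive (det′ M) ⟨
  - (- det′ M)                                    ≡⟨ cong -_ (det-swap-adjacent-rows m M r) ⟨
  - det′ S                                        ≡⟨ cong -_ (IH q S S-lo≡δ) ⟩
  - (sgn (toℕ lo ℕ.+ toℕ q) * det (suc m) (minor lo q S))
    ≡⟨ cong₂ (λ e D → - (sgn (e ℕ.+ toℕ q) * D)) (toℕ-inject₁ r) (det-cong (suc m) minor-S) ⟩
  - (sgn (toℕ r ℕ.+ toℕ q) * det (suc m) (minor hi q M))
    ≡⟨ neg-distrib (sgn (toℕ r ℕ.+ toℕ q)) _ ⟩
  sgn (toℕ hi ℕ.+ toℕ q) * det (suc m) (minor hi q M) ∎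
  where
  lo hi : Fin (suc (suc m))
  lo = inject₁ r
  hi = suc r
  det′ : Matrix (suc (suc m)) → ℤ
  det′ = det (suc (suc m))
  S : Matrix (suc (suc m))
  S = M [ lo ]≔ M hi [ hi ]≔ M lo
  S-lo≡δ : ∀ j → S lo j ≡ δ q j
  S-lo≡δ j = trans ([]≔-minimal (M [ lo ]≔ M hi) hi _ (inject₁≢suc r) j)
                   (trans ([]≔-updates M lo (M hi) j) (row≡δ j))
  minor-S : ∀ a b → minor lo q S a b ≡ minor hi q M a b
  minor-S a b with a ≟ r
  ... | yes refl = trans (cong (λ i → S i (punchIn q b)) (punchIn-inject₁-self r))
                         (trans ([]≔-updates (M [ lo ]≔ M hi) hi (M lo) _)
                                (cong (λ i → M i (punchIn q b)) (sym (punchIn-suc-self r))))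
  ... | no a≢r   = trans (cong (λ i → S i (punchIn q b)) (punchIn-inject₁≡punchIn-suc r a a≢r))
                         (trans ([]≔-minimal (M [ lo ]≔ M hi) hi _ (punchInᵢ≢i hi a) _)
                                ([]≔-minimal M lo _ avoids-lo _))
    where
    avoids-lo : punchIn hi a ≢ lo
    avoids-lo eq = punchInᵢ≢i lo a (trans (punchIn-inject₁≡punchIn-suc r a a≢r) eq)
  neg-distrib : ∀ s d → - (s * d) ≡ - (+ 1) * s * d
  neg-distrib = solve-∀

det-unit-row : ∀ n (p : Fin (suc n)) → UnitRowExpansion n p
det-unit-row n = <-weakInduction (UnitRowExpansion n) (unit-row-expansion-first n) (unit-row-expansion-step n)

sgn-double : ∀ k → sgn (k ℕ.+ k) ≡ + 1
sgn-double zero    = refl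
sgn-double (suc k) = begin
  - (+ 1) * sgn (k ℕ.+ suc k)        ≡⟨ cong (λ e → - (+ 1) * sgn e) (ℕₚ.+-suc k k) ⟩
  - (+ 1) * (- (+ 1) * sgn (k ℕ.+ k)) ≡⟨ cong (λ e → - (+ 1) * (- (+ 1) * e)) (sgn-double k) ⟩
  + 1                                 ∎

sgn-double-suc : ∀ k → sgn (k ℕ.+ suc k) ≡ - (+ 1)
sgn-double-suc k = begin
  sgn (k ℕ.+ suc k)          ≡⟨ cong sgn (ℕₚ.+-suc k k) ⟩
  - (+ 1) * sgn (k ℕ.+ k)    ≡⟨ cong (- (+ 1) *_) (sgn-double k) ⟩
  - (+ 1)                    ∎

[]≔-self : ∀ (M : Matrix n) r i j → (M [ r ]≔ M r) i j ≡ M i j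
[]≔-self M r i j with i ≟ r
... | yes refl = []≔-updates M r (M r) j
... | no i≢r   = []≔-minimal M r (M r) i≢r j

minor-[]≔-self : ∀ (M : Matrix (suc n)) p q v a b → minor p q (M [ p ]≔ v) a b ≡ minor p q M a b
minor-[]≔-self M p q v a b = []≔-minimal M p v (punchInᵢ≢i p a) (punchIn q b)

det-[]≔δ : ∀ n (M : Matrix (suc n)) p q →
  det (suc n) (M [ p ]≔ δ q) ≡ sgn (toℕ p ℕ.+ toℕ q) * det n (minor p q M)
det-[]≔δ n M p q = trans (det-unit-row n p q (M [ p ]≔ δ q) ([]≔-updates M p (δ q)))
  (cong (sgn (toℕ p ℕ.+ toℕ q) *_) (det-cong n (minor-[]≔-self M p q (δ q))))

det-subtract-adjacent-row : ∀ m (M : Matrix (suc (suc m))) r →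
  det (suc (suc m)) (M [ inject₁ r ]≔ (λ j → M (inject₁ r) j - M (suc r) j)) ≡ det (suc (suc m)) M
det-subtract-adjacent-row m M r = begin
  det′ (M [ lo ]≔ (λ j → M lo j - M hi j))
    ≡⟨ det-row-linear _ M lo (+ 1) (- (+ 1)) _ (M lo) (M hi) (λ j → as-combination (M lo j) (M hi j)) ⟩
  + 1 * det′ (M [ lo ]≔ M lo) + - (+ 1) * det′ (M [ lo ]≔ M hi)
    ≡⟨ cong₂ (λ d e → + 1 * d + - (+ 1) * e) (det-cong _ ([]≔-self M lo)) equal-rows ⟩
  + 1 * det′ M + - (+ 1) * + 0
    ≡⟨ drop-zero (det′ M) ⟩
  det′ M ∎
  where
  lo hi : Fin (suc (suc m))
  lo = inject₁ r
  hi = suc r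
  det′ : Matrix (suc (suc m)) → ℤ
  det′ = det (suc (suc m))
  equal-rows : det′ (M [ lo ]≔ M hi) ≡ + 0
  equal-rows = det-equal-adjacent-rows m (M [ lo ]≔ M hi) r λ j →
    trans ([]≔-updates M lo (M hi) j) (sym ([]≔-minimal M lo (M hi) (inject₁≢suc r ∘ sym) j))
  as-combination : ∀ a b → a - b ≡ + 1 * a + - (+ 1) * b
  as-combination = solve-∀
  drop-zero : ∀ d → + 1 * d + - (+ 1) * + 0 ≡ d
  drop-zero = solve-∀

-- Twin vertices

-- An opaque copy of charPoly: Agda then compares two of its applications argument by
-- argument instead of unfolding the determinants.
opaque
  φ : ∀ n → Matrix n → ℤ → ℤ
  φ = charPoly

  φ-unfold : ∀ n A x → φ n A x ≡ charPoly n A x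
  φ-unfold n A x = refl

typeMatrix : {A : Set} → (A → A → ℤ) → (Fin n → A) → Matrix n
typeMatrix w t i j = if ⌊ i ≟ j ⌋ then + 0 else w (t i) (t j)

module TwinVertices {A : Set} (w : A → A → ℤ) (x : ℤ) where

  χ : (Fin n → A) → Matrix n
  χ t i j = x * δ i j - typeMatrix w t i j

  χ-diag : ∀ (t : Fin n → A) i → χ t i i ≡ x
  χ-diag t i with i ≟ i
  ... | yes _   = trans (cong (_- + 0) (*-identityʳ x)) (+-identityʳ x)
  ... | no i≢i = contradiction refl i≢i

  χ-off : ∀ (t : Fin n → A) {i j} → i ≢ j → χ t i j ≡ - w (t i) (t j)
  χ-off t {i} {j} i≢j with i ≟ j
  ... | yes i≡j = contradiction i≡j i≢j
  ... | no _    = trans (cong (_- w (t i) (t j)) (*-zeroʳ x)) (+-identityˡ _)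

  χ-cong : ∀ {t t′ : Fin n → A} → t ≗ t′ → ∀ i j → χ t i j ≡ χ t′ i j
  χ-cong {t = t} {t′} t≗t′ i j = case i ≟ j of λ where
    (yes refl) → trans (χ-diag t i) (sym (χ-diag t′ i))
    (no i≢j)   → trans (χ-off t i≢j) (trans (cong₂ (λ a b → - w a b) (t≗t′ i) (t≗t′ j)) (sym (χ-off t′ i≢j)))

  χ-minor : ∀ (t : Fin (suc n) → A) p a b → minor p p (χ t) a b ≡ χ (t ∘ punchIn p) a b
  χ-minor t p a b = case a ≟ b of λ where
    (yes refl) → trans (χ-diag t (punchIn p a)) (sym (χ-diag (t ∘ punchIn p) a))
    (no a≢b)   → trans (χ-off t (a≢b ∘ punchIn-injective p a b)) (sym (χ-off (t ∘ punchIn p) a≢b))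

  φ-relabel : ∀ {t t′ : Fin n → A} → t ≗ t′ → φ n (typeMatrix w t) x ≡ φ n (typeMatrix w t′) x
  φ-relabel {n} {t} {t′} t≗t′ = begin
    φ n (typeMatrix w t) x  ≡⟨ φ-unfold n _ x ⟩
    det n (χ t)             ≡⟨ det-cong n (χ-cong t≗t′) ⟩
    det n (χ t′)            ≡⟨ φ-unfold n _ x ⟨
    φ n (typeMatrix w t′) x ∎

  module _ {m} (r : Fin (suc m)) (t : Fin (suc (suc m)) → A) {T : A}
           (t-lo : t (inject₁ r) ≡ T) (t-hi : t (suc r) ≡ T) where

    private
      lo hi : Fin (suc (suc m))
      lo = inject₁ r
      hi = suc r
      y : ℤ
      y = x + w T T
      t₁ : Fin (suc m) → A
      t₁ = t ∘ punchIn lo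
      t₂ : Fin m → A
      t₂ = t₁ ∘ punchIn r

    twin-deletion : ∀ b → t (punchIn lo b) ≡ t (punchIn hi b)
    twin-deletion b with b ≟ r
    ... | yes refl = begin
      t (punchIn lo r) ≡⟨ cong t (punchIn-inject₁-self r) ⟩
      t hi             ≡⟨ trans t-hi (sym t-lo) ⟩
      t lo             ≡⟨ cong t (punchIn-suc-self r) ⟨
      t (punchIn hi r) ∎
    ... | no b≢r = cong t (punchIn-inject₁≡punchIn-suc r b b≢r)

    twin-row-difference : ∀ j → χ t lo j - χ t hi j ≡ y * δ lo j + - y * δ hi j
    twin-row-difference j with j ≟ lo | j ≟ hi
    ... | yes refl | _ = begin
      χ t lo lo - χ t hi lo       ≡⟨ cong₂ _-_ (χ-diag t lo) (trans (χ-off t (inject₁≢suc r ∘ sym))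
                                                                   (cong₂ (λ a b → - w a b) t-hi t-lo)) ⟩
      x - - w T T                 ≡⟨ at-lo x (w T T) ⟩
      y * + 1 + - y * + 0         ≡⟨ cong₂ (λ d e → y * d + - y * e) (δ-self lo) (δ-other (inject₁≢suc r ∘ sym)) ⟨
      y * δ lo lo + - y * δ hi lo ∎
      where
      at-lo : ∀ x c → x - - c ≡ (x + c) * + 1 + - (x + c) * + 0
      at-lo = solve-∀
    ... | no _ | yes refl = begin
      χ t lo hi - χ t hi hi       ≡⟨ cong₂ _-_ (trans (χ-off t (inject₁≢suc r)) (cong₂ (λ a b → - w a b) t-lo t-hi))
                                               (χ-diag t hi) ⟩
      - w T T - x                 ≡⟨ at-hi x (w T T) ⟩
      y * + 0 + - y * + 1         ≡⟨ cong₂ (λ d e → y * d + - y * e) (δ-other (inject₁≢suc r)) (δ-self hi) ⟨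
      y * δ lo hi + - y * δ hi hi ∎
      where
      at-hi : ∀ x c → - c - x ≡ (x + c) * + 0 + - (x + c) * + 1
      at-hi = solve-∀
    ... | no j≢lo | no j≢hi = begin
      χ t lo j - χ t hi j                 ≡⟨ cong₂ _-_ (χ-off t (j≢lo ∘ sym)) (χ-off t (j≢hi ∘ sym)) ⟩
      - w (t lo) (t j) - - w (t hi) (t j) ≡⟨ cong (λ a → - w (t lo) (t j) - - w a (t j)) (trans t-hi (sym t-lo)) ⟩
      - w (t lo) (t j) - - w (t lo) (t j) ≡⟨ elsewhere (w (t lo) (t j)) y ⟩
      y * + 0 + - y * + 0
        ≡⟨ cong₂ (λ d e → y * d + - y * e) (δ-other (j≢lo ∘ sym)) (δ-other (j≢hi ∘ sym)) ⟨
      y * δ lo j + - y * δ hi j           ∎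
      where
      elsewhere : ∀ c y → - c - - c ≡ y * + 0 + - y * + 0
      elsewhere = solve-∀

    private
      D₁ D₂ : ℤ
      D₁ = det (suc m) (χ t₁)
      D₂ = det m (χ t₂)

    expand-at-lo : det (suc (suc m)) (χ t [ lo ]≔ δ lo) ≡ D₁
    expand-at-lo = begin
      det (suc (suc m)) (χ t [ lo ]≔ δ lo)               ≡⟨ det-[]≔δ (suc m) (χ t) lo lo ⟩
      sgn (toℕ lo ℕ.+ toℕ lo) * det (suc m) (minor lo lo (χ t))
        ≡⟨ cong₂ _*_ (sgn-double (toℕ lo)) (det-cong (suc m) (χ-minor t lo)) ⟩
      + 1 * D₁                                           ≡⟨ *-identityˡ D₁ ⟩
      D₁                                                 ∎

    minor-lo-hi : ∀ a b → minor lo hi (χ t) a b ≡ (χ t₁ [ r ]≔ (λ c → χ t₁ r c + - y * δ r c)) a b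
    minor-lo-hi a b with a ≟ r
    ... | no a≢r = begin
      χ t (punchIn lo a) (punchIn hi b) ≡⟨ cong (λ i → χ t i (punchIn hi b)) (punchIn-inject₁≡punchIn-suc r a a≢r) ⟩
      minor hi hi (χ t) a b             ≡⟨ χ-minor t hi a b ⟩
      χ (t ∘ punchIn hi) a b            ≡⟨ χ-cong twin-deletion a b ⟨
      χ t₁ a b                          ≡⟨ []≔-minimal (χ t₁) r _ a≢r b ⟨
      (χ t₁ [ r ]≔ (λ c → χ t₁ r c + - y * δ r c)) a b ∎
    ... | yes refl = trans (cong (λ i → χ t i (punchIn hi b)) (punchIn-inject₁-self r))
                           (trans (row-hi b) (sym ([]≔-updates (χ t₁) r _ b)))
      where
      row-hi : ∀ b → χ t hi (punchIn hi b) ≡ χ t₁ r b + - y * δ r b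
      row-hi b with b ≟ r
      ... | yes refl = begin
        χ t hi (punchIn hi r)   ≡⟨ cong (χ t hi) (punchIn-suc-self r) ⟩
        χ t hi lo               ≡⟨ trans (χ-off t (inject₁≢suc r ∘ sym)) (cong₂ (λ a b → - w a b) t-hi t-lo) ⟩
        - w T T                 ≡⟨ absorb x (w T T) ⟩
        x + - y * + 1           ≡⟨ cong₂ (λ d e → d + - y * e) (χ-diag t₁ r) (δ-self r) ⟨
        χ t₁ r r + - y * δ r r  ∎
        where
        absorb : ∀ x c → - c ≡ x + - (x + c) * + 1
        absorb = solve-∀
      ... | no b≢r = begin
        χ t hi (punchIn hi b)                     ≡⟨ χ-off t (punchInᵢ≢i hi b ∘ sym) ⟩
        - w (t hi) (t (punchIn hi b))
          ≡⟨ cong₂ (λ a c → - w a c) (cong t (punchIn-inject₁-self r)) (twin-deletion b) ⟨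
        - w (t₁ r) (t₁ b)                         ≡⟨ χ-off t₁ (b≢r ∘ sym) ⟨
        χ t₁ r b                                  ≡⟨ +-identityʳ (χ t₁ r b) ⟨
        χ t₁ r b + + 0
          ≡⟨ cong (_+_ (χ t₁ r b)) (trans (cong (- y *_) (δ-other (b≢r ∘ sym))) (*-zeroʳ (- y))) ⟨
        χ t₁ r b + - y * δ r b                    ∎

    expand-at-hi : det (suc (suc m)) (χ t [ lo ]≔ δ hi) ≡ - (+ 1) * (D₁ + - y * D₂)
    expand-at-hi = begin
      det (suc (suc m)) (χ t [ lo ]≔ δ hi)
        ≡⟨ det-[]≔δ (suc m) (χ t) lo hi ⟩
      sgn (toℕ lo ℕ.+ toℕ hi) * det (suc m) (minor lo hi (χ t))
        ≡⟨ cong₂ _*_ (trans (cong (λ k → sgn (k ℕ.+ toℕ hi)) (toℕ-inject₁ r)) (sgn-double-suc (toℕ r)))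
                     (det-cong (suc m) minor-lo-hi) ⟩
      - (+ 1) * det (suc m) (χ t₁ [ r ]≔ (λ c → χ t₁ r c + - y * δ r c))
        ≡⟨ cong (- (+ 1) *_) (det-row-linear (suc m) (χ t₁) r (+ 1) (- y) _ (χ t₁ r) (δ r)
                                               (λ c → cong (_+ - y * δ r c) (sym (*-identityˡ (χ t₁ r c))))) ⟩
      - (+ 1) * (+ 1 * det (suc m) (χ t₁ [ r ]≔ χ t₁ r) + - y * det (suc m) (χ t₁ [ r ]≔ δ r))
        ≡⟨ cong₂ (λ d e → - (+ 1) * (d + - y * e))
                 (trans (*-identityˡ _) (det-cong (suc m) ([]≔-self (χ t₁) r)))
                 (trans (det-[]≔δ m (χ t₁) r r)
                        (cong₂ _*_ (sgn-double (toℕ r)) (det-cong m (χ-minor t₁ r)))) ⟩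
      - (+ 1) * (D₁ + - y * (+ 1 * D₂))
        ≡⟨ cong (λ e → - (+ 1) * (D₁ + - y * e)) (*-identityˡ D₂) ⟩
      - (+ 1) * (D₁ + - y * D₂) ∎

    -- Row lo minus row hi is y (δ lo − δ hi); expanding along it gives D₁ and − (D₁ − y D₂).
    φ-twins : φ (suc (suc m)) (typeMatrix w t) x
      ≡ (x + w T T) * (+ 2 * φ (suc m) (typeMatrix w (t ∘ punchIn (inject₁ r))) x
                       - (x + w T T) * φ m (typeMatrix w (t ∘ punchIn (inject₁ r) ∘ punchIn r)) x)
    φ-twins = begin
      φ (suc (suc m)) (typeMatrix w t) x
        ≡⟨ φ-unfold (suc (suc m)) _ x ⟩
      det (suc (suc m)) (χ t)
        ≡⟨ det-subtract-adjacent-row m (χ t) r ⟨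
      det (suc (suc m)) (χ t [ lo ]≔ (λ j → χ t lo j - χ t hi j))
        ≡⟨ det-row-linear (suc (suc m)) (χ t) lo y (- y) _ (δ lo) (δ hi) twin-row-difference ⟩
      y * det (suc (suc m)) (χ t [ lo ]≔ δ lo) + - y * det (suc (suc m)) (χ t [ lo ]≔ δ hi)
        ≡⟨ cong₂ (λ d e → y * d + - y * e) expand-at-lo expand-at-hi ⟩
      y * D₁ + - y * (- (+ 1) * (D₁ + - y * D₂))
        ≡⟨ collect y D₁ D₂ ⟩
      y * (+ 2 * D₁ - y * D₂)
        ≡⟨ cong₂ (λ d e → y * (+ 2 * d - y * e)) (φ-unfold (suc m) _ x) (φ-unfold m _ x) ⟨
      y * (+ 2 * φ (suc m) (typeMatrix w t₁) x - y * φ m (typeMatrix w t₂) x) ∎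
      where
      collect : ∀ y d e → y * d + - y * (- (+ 1) * (d + - y * e)) ≡ y * (+ 2 * d - y * e)
      collect = solve-∀

twin-recurrence-solution : ∀ (f : ℕ → ℤ) y → (∀ m → f (suc (suc m)) ≡ y * (+ 2 * f (suc m) - y * f m)) →
  ∀ m → f (suc m) ≡ y ^ m * (+ suc m * f 1 - + m * y * f 0)
twin-recurrence-solution f y rec m = proj₁ (consecutive m)
  where
  consecutive : ∀ m → f (suc m) ≡ y ^ m * (+ suc m * f 1 - + m * y * f 0)
                    × f (suc (suc m)) ≡ y ^ suc m * (+ suc (suc m) * f 1 - + suc m * y * f 0)
  consecutive zero    = initial (f 1) (f 0) y , trans (rec 0) (first-step (f 1) (f 0) y)
    where
    initial : ∀ a b y → a ≡ + 1 * (+ 1 * a - + 0 * y * b)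
    initial = solve-∀
    first-step : ∀ a b y → y * (+ 2 * a - y * b) ≡ y * + 1 * (+ 2 * a - + 1 * y * b)
    first-step = solve-∀
  consecutive (suc m) with consecutive m
  ... | fₘ₊₁ , fₘ₊₂ = fₘ₊₂ , (begin
    f (3 ℕ.+ m)
      ≡⟨ rec (suc m) ⟩
    y * (+ 2 * f (2 ℕ.+ m) - y * f (1 ℕ.+ m))
      ≡⟨ cong₂ (λ a b → y * (+ 2 * a - y * b)) fₘ₊₂ fₘ₊₁ ⟩
    y * (+ 2 * (y ^ suc m * (+ suc (suc m) * f 1 - + suc m * y * f 0))
         - y * (y ^ m * (+ suc m * f 1 - + m * y * f 0)))
      ≡⟨ step y (y ^ m) (f 1) (f 0) (+ m) ⟩
    y ^ suc (suc m) * (+ suc (suc (suc m)) * f 1 - + suc (suc m) * y * f 0) ∎)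
    where
    step : ∀ y Z a b k →
      y * (+ 2 * ((y * Z) * ((+ 2 + k) * a - (+ 1 + k) * y * b)) - y * (Z * ((+ 1 + k) * a - k * y * b)))
        ≡ (y * (y * Z)) * ((+ 3 + k) * a - (+ 2 + k) * y * b)
    step = solve-∀

-- The graph (K_n, U₁⁻)

data Role : Set where
  apex base pendant outside : Role

role : ℕ → ℕ → Role
role k 0 = apex
role k 1 = base
role k 2 = base
role k a = if a <ᵇ k then pendant else outside

-- U₁ in Defs also relates each triangle vertex to itself, hence apex–apex.
adjacent : Role → Role → Bool
adjacent apex    apex    = true
adjacent apex    base    = true
adjacent apex    pendant = true
adjacent base    apex    = true
adjacent base    base    = true
adjacent pendant apex    = true
adjacent _       _       = false

U₁-role : ∀ p (i j : Fin n) → U₁ (3 ℕ.+ p) i j ≡ adjacent (role (3 ℕ.+ p) (toℕ i)) (role (3 ℕ.+ p) (toℕ j))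
U₁-role p zero                 zero                 = refl
U₁-role p zero                 (suc zero)           = refl
U₁-role p zero                 (suc (suc zero))     = refl
U₁-role p zero                 (suc (suc (suc j)))  with toℕ j <ᵇ p
... | true  = refl
... | false = refl
U₁-role p (suc zero)           zero                 = refl
U₁-role p (suc zero)           (suc zero)           = refl
U₁-role p (suc zero)           (suc (suc zero))     = refl
U₁-role p (suc zero)           (suc (suc (suc j)))  with toℕ j <ᵇ p
... | true  = refl
... | false = refl
U₁-role p (suc (suc zero))     zero                 = refl
U₁-role p (suc (suc zero))     (suc zero)           = refl
U₁-role p (suc (suc zero))     (suc (suc zero))     = refl
U₁-role p (suc (suc zero))     (suc (suc (suc j)))  with toℕ j <ᵇ p
... | true  = refl
... | false = refl
U₁-role p (suc (suc (suc i)))  zero                 with toℕ i <ᵇ p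
... | true  = refl
... | false = refl
U₁-role p (suc (suc (suc i)))  (suc zero)           with toℕ i <ᵇ p
... | true  = refl
... | false = refl
U₁-role p (suc (suc (suc i)))  (suc (suc zero))     with toℕ i <ᵇ p
... | true  = refl
... | false = refl
U₁-role p (suc (suc (suc i)))  (suc (suc (suc j)))  with toℕ i <ᵇ p | toℕ j <ᵇ p
... | true  | true  = refl
... | true  | false = refl
... | false | true  = refl
... | false | false = refl

signWeight : Role → Role → ℤ
signWeight s t = if adjacent s t then - (+ 1) else + 1

φU₁ : ℕ → ℕ → ℤ → ℤ
φU₁ n k x = φ n (typeMatrix signWeight (role k ∘ toℕ)) x

charPoly-U₁ : ∀ n p x → charPoly n (signedKnAdj n (U₁ (3 ℕ.+ p))) x ≡ φU₁ n (3 ℕ.+ p) x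
charPoly-U₁ n p x = trans (det-cong n λ i j →
  cong (λ e → x * δ i j - (if ⌊ i ≟ j ⌋ then + 0 else if e then - (+ 1) else + 1)) (U₁-role p i j))
  (sym (φ-unfold n _ x))

role-delete-pendant : ∀ p (i : Fin (3 ℕ.+ n)) →
  role (4 ℕ.+ p) (toℕ (punchIn (suc (suc (suc zero))) i)) ≡ role (3 ℕ.+ p) (toℕ i)
role-delete-pendant p zero                = refl
role-delete-pendant p (suc zero)          = refl
role-delete-pendant p (suc (suc zero))    = refl
role-delete-pendant p (suc (suc (suc i))) = refl

role-delete-outside₀ : ∀ (i : Fin (3 ℕ.+ n)) →
  role 3 (toℕ (punchIn (suc (suc (suc zero))) i)) ≡ role 3 (toℕ i)
role-delete-outside₀ zero                = refl
role-delete-outside₀ (suc zero)          = refl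
role-delete-outside₀ (suc (suc zero))    = refl
role-delete-outside₀ (suc (suc (suc i))) = refl

role-delete-outside₁ : ∀ (i : Fin (4 ℕ.+ n)) →
  role 4 (toℕ (punchIn (suc (suc (suc (suc zero)))) i)) ≡ role 4 (toℕ i)
role-delete-outside₁ zero                      = refl
role-delete-outside₁ (suc zero)                = refl
role-delete-outside₁ (suc (suc zero))          = refl
role-delete-outside₁ (suc (suc (suc zero)))    = refl
role-delete-outside₁ (suc (suc (suc (suc i)))) = refl

open TwinVertices signWeight using (φ-relabel; φ-twins)

φU₁-twin-recurrence : ∀ {m} (r : Fin (suc m)) k k₁ k₂ T x →
  role k (toℕ (inject₁ r)) ≡ T → role k (toℕ (suc r)) ≡ T →
  (∀ i → role k (toℕ (punchIn (inject₁ r) i)) ≡ role k₁ (toℕ i)) →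
  (∀ i → role k₁ (toℕ (punchIn r i)) ≡ role k₂ (toℕ i)) →
  φU₁ (suc (suc m)) k x ≡ (x + signWeight T T) * (+ 2 * φU₁ (suc m) k₁ x - (x + signWeight T T) * φU₁ m k₂ x)
φU₁-twin-recurrence r k k₁ k₂ T x t-lo t-hi delete₁ delete₂ = begin
  φU₁ _ k x
    ≡⟨ φ-twins x r (role k ∘ toℕ) t-lo t-hi ⟩
  y * (+ 2 * φ _ (typeMatrix signWeight (role k ∘ toℕ ∘ punchIn (inject₁ r))) x
       - y * φ _ (typeMatrix signWeight (role k ∘ toℕ ∘ punchIn (inject₁ r) ∘ punchIn r)) x)
    ≡⟨ cong₂ (λ d e → y * (+ 2 * d - y * e))
             (φ-relabel x delete₁) (φ-relabel x λ i → trans (delete₁ (punchIn r i)) (delete₂ i)) ⟩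
  y * (+ 2 * φU₁ _ k₁ x - y * φU₁ _ k₂ x) ∎
  where
  y : ℤ
  y = x + signWeight T T

φU₁-pendant-recurrence : ∀ n p x →
  φU₁ (5 ℕ.+ n) (5 ℕ.+ p) x
    ≡ (x + + 1) * (+ 2 * φU₁ (4 ℕ.+ n) (4 ℕ.+ p) x - (x + + 1) * φU₁ (3 ℕ.+ n) (3 ℕ.+ p) x)
φU₁-pendant-recurrence n p x = φU₁-twin-recurrence (suc (suc (suc zero))) (5 ℕ.+ p) (4 ℕ.+ p) (3 ℕ.+ p) pendant x
  refl refl (role-delete-pendant (suc p)) (role-delete-pendant p)

φU₁-outside-recurrence₀ : ∀ n x →
  φU₁ (5 ℕ.+ n) 3 x ≡ (x + + 1) * (+ 2 * φU₁ (4 ℕ.+ n) 3 x - (x + + 1) * φU₁ (3 ℕ.+ n) 3 x)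
φU₁-outside-recurrence₀ n x = φU₁-twin-recurrence (suc (suc (suc zero))) 3 3 3 outside x
  refl refl role-delete-outside₀ role-delete-outside₀

φU₁-outside-recurrence₁ : ∀ n x →
  φU₁ (6 ℕ.+ n) 4 x ≡ (x + + 1) * (+ 2 * φU₁ (5 ℕ.+ n) 4 x - (x + + 1) * φU₁ (4 ℕ.+ n) 4 x)
φU₁-outside-recurrence₁ n x = φU₁-twin-recurrence (suc (suc (suc (suc zero)))) 4 4 4 outside x
  refl refl role-delete-outside₁ role-delete-outside₁

-- The determinant and characteristic polynomial in the ring solver's syntax: for a concrete
-- size, ⟦ charPolyᴱ n A x ⟧ unfolds to charPoly n A x, so the solver can expand it.
sumᴱ : ∀ {m} n → (Fin n → Polynomial m) → Polynomial m
sumᴱ zero    f = con (+ 0)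
sumᴱ (suc n) f = f zero :+ sumᴱ n (f ∘ suc)

detᴱ : ∀ {m} n → (Fin n → Fin n → Polynomial m) → Polynomial m
detᴱ zero    M = con (+ 1)
detᴱ (suc n) M = sumᴱ (suc n) λ j → con (sgn (toℕ j)) :* M zero j :* detᴱ n (λ r c → M (suc r) (punchIn j c))

charPolyᴱ : ∀ {m} n → Matrix n → Polynomial m → Polynomial m
charPolyᴱ n A x = detᴱ n λ i j → x :* con (δ i j) :- con (A i j)

Φ₃₃ Φ₄₃ Φ₄₄ Φ₅₄ : ∀ {m} → Polynomial m → Polynomial m
Φ₃₃ x = x :^ 3 :- con (+ 3) :* x :+ con (+ 2)
Φ₄₃ x = x :^ 4 :- con (+ 6) :* x :^ 2 :+ con (+ 8) :* x :- con (+ 3)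
Φ₄₄ x = x :^ 4 :- con (+ 6) :* x :^ 2 :+ con (+ 5)
Φ₅₄ x = x :^ 5 :- con (+ 10) :* x :^ 3 :+ con (+ 4) :* x :^ 2 :+ con (+ 17) :* x :- con (+ 12)

⟦_⟧₁ : (∀ {m} → Polynomial m → Polynomial m) → ℤ → ℤ
⟦ P ⟧₁ x = ⟦ P (var zero) ⟧ (x Vec.∷ Vec.[])

φ₃₃ φ₄₃ φ₄₄ φ₅₄ : ℤ → ℤ
φ₃₃ = ⟦ Φ₃₃ ⟧₁
φ₄₃ = ⟦ Φ₄₃ ⟧₁
φ₄₄ = ⟦ Φ₄₄ ⟧₁
φ₅₄ = ⟦ Φ₅₄ ⟧₁

φU₁-3-3 : ∀ x → φU₁ 3 3 x ≡ φ₃₃ x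
φU₁-3-3 x = trans (φ-unfold 3 _ x)
  (solve 1 (λ x → charPolyᴱ 3 (typeMatrix signWeight (role 3 ∘ toℕ)) x := Φ₃₃ x) refl x)

φU₁-4-3 : ∀ x → φU₁ 4 3 x ≡ φ₄₃ x
φU₁-4-3 x = trans (φ-unfold 4 _ x)
  (solve 1 (λ x → charPolyᴱ 4 (typeMatrix signWeight (role 3 ∘ toℕ)) x := Φ₄₃ x) refl x)

φU₁-4-4 : ∀ x → φU₁ 4 4 x ≡ φ₄₄ x
φU₁-4-4 x = trans (φ-unfold 4 _ x)
  (solve 1 (λ x → charPolyᴱ 4 (typeMatrix signWeight (role 4 ∘ toℕ)) x := Φ₄₄ x) refl x)

φU₁-5-4 : ∀ x → φU₁ 5 4 x ≡ φ₅₄ x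
φU₁-5-4 x = trans (φ-unfold 5 _ x)
  (solve 1 (λ x → charPolyᴱ 5 (typeMatrix signWeight (role 4 ∘ toℕ)) x := Φ₅₄ x) refl x)

φU₁-pendants : ∀ p u x → φU₁ (3 ℕ.+ suc p ℕ.+ u) (4 ℕ.+ p) x
  ≡ (x + + 1) ^ p * (+ suc p * φU₁ (4 ℕ.+ u) 4 x - + p * (x + + 1) * φU₁ (3 ℕ.+ u) 3 x)
φU₁-pendants p u x = twin-recurrence-solution (λ q → φU₁ (3 ℕ.+ q ℕ.+ u) (3 ℕ.+ q) x) (x + + 1)
  (λ q → φU₁-pendant-recurrence (q ℕ.+ u) q x) p

φU₁-without-outside : ∀ p x →
  φU₁ (4 ℕ.+ p) (4 ℕ.+ p) x ≡ (x + + 1) ^ p * (+ suc p * φ₄₄ x - + p * (x + + 1) * φ₃₃ x)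
φU₁-without-outside p x = trans
  (twin-recurrence-solution (λ q → φU₁ (3 ℕ.+ q) (3 ℕ.+ q) x) (x + + 1) (λ q → φU₁-pendant-recurrence q q x) p)
  (cong₂ (λ a b → (x + + 1) ^ p * (+ suc p * a - + p * (x + + 1) * b)) (φU₁-4-4 x) (φU₁-3-3 x))

φU₁-outside₀ : ∀ u x → φU₁ (4 ℕ.+ u) 3 x ≡ (x + + 1) ^ u * (+ suc u * φ₄₃ x - + u * (x + + 1) * φ₃₃ x)
φU₁-outside₀ u x = trans
  (twin-recurrence-solution (λ v → φU₁ (3 ℕ.+ v) 3 x) (x + + 1) (λ v → φU₁-outside-recurrence₀ v x) u)
  (cong₂ (λ a b → (x + + 1) ^ u * (+ suc u * a - + u * (x + + 1) * b)) (φU₁-4-3 x) (φU₁-3-3 x))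

φU₁-outside₁ : ∀ u x → φU₁ (5 ℕ.+ u) 4 x ≡ (x + + 1) ^ u * (+ suc u * φ₅₄ x - + u * (x + + 1) * φ₄₄ x)
φU₁-outside₁ u x = trans
  (twin-recurrence-solution (λ v → φU₁ (4 ℕ.+ v) 4 x) (x + + 1) (λ v → φU₁-outside-recurrence₁ v x) u)
  (cong₂ (λ a b → (x + + 1) ^ u * (+ suc u * a - + u * (x + + 1) * b)) (φU₁-5-4 x) (φU₁-4-4 x))

-- The factorisation

Quartic : ∀ {m} → Polynomial m → Polynomial m → Polynomial m → Polynomial m
Quartic n k x = x :^ 4 :+ (con (+ 6) :- n) :* x :^ 3 :+ (con (+ 16) :- con (+ 5) :* n) :* x :^ 2
  :+ (con (+ 4) :* k :- con (+ 11) :* n :+ con (+ 4) :* k :* (n :- k) :+ con (+ 18)) :* x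
  :+ con (+ 28) :* k :- con (+ 31) :* n :+ con (+ 12) :* k :* (n :- k) :+ con (+ 7)

quartic : ℤ → ℤ → ℤ → ℤ
quartic n k x = ⟦ Quartic (var zero) (var (suc zero)) (var (suc (suc zero))) ⟧ (n Vec.∷ k Vec.∷ x Vec.∷ Vec.[])

identity-3-3 : ∀ x → φ₃₃ x * (x + + 1) ^ 2 ≡ (x + + 1) ^ 0 * (x - + 1) * quartic (+ 3) (+ 3) x
identity-3-3 = solve 1 (λ x → Φ₃₃ x :* (x :+ con (+ 1)) :^ 2
                              := (x :+ con (+ 1)) :^ 0 :* (x :- con (+ 1)) :* Quartic (con (+ 3)) (con (+ 3)) x) refl

identity-outside : ∀ x u →
  (x + + 1) * ((+ 1 + u) * φ₄₃ x - u * (x + + 1) * φ₃₃ x) ≡ (x - + 1) * quartic (+ 4 + u) (+ 3) x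
identity-outside = solve 2 (λ x u →
  (x :+ con (+ 1)) :* ((con (+ 1) :+ u) :* Φ₄₃ x :- u :* (x :+ con (+ 1)) :* Φ₃₃ x)
    := (x :- con (+ 1)) :* Quartic (con (+ 4) :+ u) (con (+ 3)) x) refl

identity-pendants : ∀ x p →
  (x + + 1) * ((+ 1 + p) * φ₄₄ x - p * (x + + 1) * φ₃₃ x) ≡ (x - + 1) * quartic (+ 4 + p) (+ 4 + p) x
identity-pendants = solve 2 (λ x p →
  (x :+ con (+ 1)) :* ((con (+ 1) :+ p) :* Φ₄₄ x :- p :* (x :+ con (+ 1)) :* Φ₃₃ x)
    := (x :- con (+ 1)) :* Quartic (con (+ 4) :+ p) (con (+ 4) :+ p) x) refl

identity-both : ∀ x p u →
  (+ 1 + p) * ((+ 1 + u) * φ₅₄ x - u * (x + + 1) * φ₄₄ x)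
    - p * (x + + 1) * ((+ 1 + u) * φ₄₃ x - u * (x + + 1) * φ₃₃ x)
    ≡ (x - + 1) * quartic (+ 4 + (p + (+ 1 + u))) (+ 4 + p) x
identity-both = solve 3 (λ x p u →
  (con (+ 1) :+ p) :* ((con (+ 1) :+ u) :* Φ₅₄ x :- u :* (x :+ con (+ 1)) :* Φ₄₄ x)
    :- p :* (x :+ con (+ 1)) :* ((con (+ 1) :+ u) :* Φ₄₃ x :- u :* (x :+ con (+ 1)) :* Φ₃₃ x)
    := (x :- con (+ 1)) :* Quartic (con (+ 4) :+ (p :+ (con (+ 1) :+ u))) (con (+ 4) :+ p) x) refl

balance-powers : ∀ (y a c b d : ℤ) n m → n ≡ 4 ℕ.+ m → a ≡ y ^ m * c → y * c ≡ b * d →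
  a * y ^ (5 ∸ n) ≡ y ^ (n ∸ 5) * b * d
balance-powers y a c b d _ zero refl a≡ yc≡bd = begin
  a * y ^ 1               ≡⟨ cong (_* y ^ 1) a≡ ⟩
  y ^ 0 * c * y ^ 1       ≡⟨ reorder y c ⟩
  y * c                   ≡⟨ yc≡bd ⟩
  b * d                   ≡⟨ cong (_* d) (*-identityˡ b) ⟨
  y ^ 0 * b * d           ∎
  where
  reorder : ∀ y c → + 1 * c * (y * + 1) ≡ y * c
  reorder = solve-∀
balance-powers y a c b d _ (suc m) refl a≡ yc≡bd = begin
  a * y ^ (0 ∸ m)         ≡⟨ cong (λ e → a * y ^ e) (ℕₚ.0∸n≡0 m) ⟩
  a * + 1                 ≡⟨ *-identityʳ a ⟩
  a                       ≡⟨ a≡ ⟩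
  y * y ^ m * c           ≡⟨ reorder y (y ^ m) c ⟩
  y ^ m * (y * c)         ≡⟨ cong (y ^ m *_) yc≡bd ⟩
  y ^ m * (b * d)         ≡⟨ *-assoc (y ^ m) b d ⟨
  y ^ m * b * d           ∎
  where
  reorder : ∀ y z c → y * z * c ≡ z * (y * c)
  reorder = solve-∀

-- The truncated powers make this uniform in n: for n < 5 the power (x + 1) ^ (5 ∸ n) moves to the left.
Factorisation : ℕ → ℕ → ℤ → Set
Factorisation n k x = φU₁ n k x * (x + + 1) ^ (5 ∸ n) ≡ (x + + 1) ^ (n ∸ 5) * (x - + 1) * quartic (+ n) (+ k) x

φU₁-factorisation : ∀ p u x → Factorisation (3 ℕ.+ p ℕ.+ u) (3 ℕ.+ p) x
φU₁-factorisation zero zero x = trans (cong (_* (x + + 1) ^ 2) (φU₁-3-3 x)) (identity-3-3 x)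
φU₁-factorisation zero (suc u) x =
  balance-powers (x + + 1) _ _ (x - + 1) _ (4 ℕ.+ u) u refl (φU₁-outside₀ u x) (identity-outside x (+ u))
φU₁-factorisation (suc p) zero x = subst (λ n → Factorisation n (4 ℕ.+ p) x) (sym (ℕₚ.+-identityʳ (4 ℕ.+ p)))
  (balance-powers (x + + 1) _ _ (x - + 1) _ (4 ℕ.+ p) p refl (φU₁-without-outside p x) (identity-pendants x (+ p)))
φU₁-factorisation (suc p) (suc u) x = begin
  φU₁ order (4 ℕ.+ p) x * y ^ (5 ∸ order)
    ≡⟨ cong₂ _*_ closed-form (cong (y ^_) (trans (cong (1 ∸_) (ℕₚ.+-suc p u)) (ℕₚ.0∸n≡0 (p ℕ.+ u)))) ⟩
  y ^ p * (+ suc p * (y ^ u * A) - + p * y * (y ^ u * B)) * + 1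
    ≡⟨ regroup (y ^ p) (y ^ u) (+ p) y A B ⟩
  y ^ p * y ^ u * ((+ 1 + + p) * A - + p * y * B)
    ≡⟨ cong₂ _*_ (sym (^-distribˡ-+-* y p u)) (identity-both x (+ p) (+ u)) ⟩
  y ^ (p ℕ.+ u) * ((x - + 1) * quartic (+ order) (+ (4 ℕ.+ p)) x)
    ≡⟨ *-assoc (y ^ (p ℕ.+ u)) _ _ ⟨
  y ^ (p ℕ.+ u) * (x - + 1) * quartic (+ order) (+ (4 ℕ.+ p)) x
    ≡⟨ cong (λ e → y ^ e * (x - + 1) * quartic (+ order) (+ (4 ℕ.+ p)) x) (cong (_∸ 1) (ℕₚ.+-suc p u)) ⟨
  y ^ (order ∸ 5) * (x - + 1) * quartic (+ order) (+ (4 ℕ.+ p)) x ∎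
  where
  order : ℕ
  order = 3 ℕ.+ suc p ℕ.+ suc u
  y A B : ℤ
  y = x + + 1
  A = (+ 1 + + u) * φ₅₄ x - + u * y * φ₄₄ x
  B = (+ 1 + + u) * φ₄₃ x - + u * y * φ₃₃ x
  closed-form : φU₁ order (4 ℕ.+ p) x ≡ y ^ p * (+ suc p * (y ^ u * A) - + p * y * (y ^ u * B))
  closed-form = trans (φU₁-pendants p (suc u) x)
    (cong₂ (λ a b → y ^ p * (+ suc p * a - + p * y * b)) (φU₁-outside₁ u x) (φU₁-outside₀ u x))
  regroup : ∀ zₚ zᵤ P y A B →
    zₚ * ((+ 1 + P) * (zᵤ * A) - P * y * (zᵤ * B)) * + 1 ≡ zₚ * zᵤ * ((+ 1 + P) * A - P * y * B)
  regroup = solve-∀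

lemma8 : (n k : ℕ) → 3 ≤ k → k ≤ n → (x : ℤ) →
    charPoly n (signedKnAdj n (U₁ k)) x * (x + + 1) ^ (5 ∸ n)
      ≡ (x + + 1) ^ (n ∸ 5) * (x - + 1)
        * (x ^ 4 + (+ 6 - + n) * x ^ 3 + (+ 16 - + 5 * + n) * x ^ 2
           + (+ 4 * + k - + 11 * + n + + 4 * + k * (+ n - + k) + + 18) * x
           + + 28 * + k - + 31 * + n + + 12 * + k * (+ n - + k) + + 7)
lemma8 n k 3≤k k≤n x with ℕₚ.m≤n⇒∃[o]m+o≡n 3≤k
... | p , refl with ℕₚ.m≤n⇒∃[o]m+o≡n k≤n
... | u , refl = trans (cong (_* (x + + 1) ^ (5 ∸ n)) (charPoly-U₁ n p x)) (φU₁-factorisation p u x)
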